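{- Let $x,y$ be Lucas strings of length $n$ with $y=x+\delta_i$. Then for every $j\in[1,n]$ with $j\notin\{\mathbf{i-1},\mathbf{i+1}\}$, $x+\delta_j$ is a Lucas string if and only if $y+\delta_j$ is a Lucas string.
   Context: A Lucas string of length $n$ is a binary string $b_1\ldots b_n$ with no two consecutive 1's and with $b_1b_n\neq 1$. For a binary string $x=x_1\ldots x_n$ and $i\in[1,n]$, $x+\delta_i$ denotes the string obtained from $x$ by complementing its $i$-th coordinate. For an integer $k$, $\mathbf{k}=((k-1)\bmod n)+1\in[1,n]$, so that $\mathbf{n+1}=1$ and $\mathbf{0}=n$. -}

module Defs where

open import Data.Nat using (ℕ; zero; suc; _+_; _<_; s≤s; NonZero)
open import Data.Nat.Properties using (<-trans; n<1+n)
open import Data.Nat.DivMod using (_mod_)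
open import Data.Fin using (Fin; toℕ; fromℕ<)
open import Data.Bool using (Bool; true; false; not; _∧_)
open import Data.Product using (_×_)
open import Relation.Binary.PropositionalEquality using (_≡_)
open import Relation.Nullary using (¬_; yes; no)
import Data.Fin as Fin

-- A binary string of length n: b : Fin n → Bool.  Coordinate k ∈ [1,n] of the
-- paper is the index (k - 1) : Fin n; true = 1, false = 0.
BinStr : ℕ → Set
BinStr n = Fin n → Bool

NoConsecutiveOnes : (n : ℕ) → BinStr n → Set
NoConsecutiveOnes n b =
  (k : ℕ) (p : suc k < n) → ¬ (b (fromℕ< (<-trans (n<1+n k) p)) ∧ b (fromℕ< p) ≡ true)

-- b_1 b_n ≠ 1  (vacuous for n = 0)
FirstLastNotBoth : (n : ℕ) → BinStr n → Set
FirstLastNotBoth zero    b = ¬ (true ≡ false)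
FirstLastNotBoth (suc m) b = ¬ (b Fin.zero ∧ b (Fin.fromℕ m) ≡ true)

IsLucas : (n : ℕ) → BinStr n → Set
IsLucas n b = NoConsecutiveOnes n b × FirstLastNotBoth n b

flip : {n : ℕ} → BinStr n → Fin n → BinStr n
flip x i j with i Fin.≟ j
... | yes _ = not (x j)
... | no  _ = x j

-- cyclic index bold(k) = ((k-1) mod n) + 1; in 0-based terms, index m ↦ m mod n.
-- cyc i d  is the 0-based index of bold(i + d) where i is 0-based.
cycShift : {n : ℕ} → Fin n → ℕ → Fin n
cycShift {suc m} i d = (toℕ i + d) mod (suc m)

-- 0-based index of bold(i+1) and bold(i-1) (i-1 ≡ i + (n-1) mod n)
next prev : {n : ℕ} → Fin n → Fin n
next i = cycShift i 1
prev {suc m} i = cycShift i m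

module Submission where

-- Read the Lucas condition cyclically: no two ones at cyclically adjacent positions a, a + 1.
-- If j = i, then x + δ_j = y and y + δ_j = x are Lucas anyway.  Otherwise an adjacent pair
-- containing i cannot contain j, because j ∉ {i − 1, i + 1}; so on every adjacent pair the
-- string y + δ_j agrees with y (if the pair contains i) or with x + δ_j (if it avoids i).
-- Hence x + δ_j Lucas implies y + δ_j Lucas, and the converse is the same argument
-- applied to x = y + δ_i.

open import Defs
open import Data.Nat using (ℕ; zero; suc; _+_; _<_; s≤s)
import Data.Nat as ℕ
open import Data.Nat.Properties using (+-assoc; +-comm; ≤∧≢⇒<; <-trans; n<1+n)
open import Data.Nat.DivMod
  using (_%_; n%n≡0; m%n%n≡m%n; %-distribˡ-+; [m+n]%n≡m%n; m<n⇒m%n≡m)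
open import Data.Fin using (Fin; zero; toℕ; fromℕ; fromℕ<; _≟_)
open import Data.Fin.Properties
  using (toℕ-injective; toℕ-fromℕ<; fromℕ<-toℕ; toℕ-fromℕ; toℕ<n; toℕ≤pred[n])
open import Data.Bool using (true; not; _∧_)
open import Data.Bool.Properties using (not-involutive; ∧-comm)
open import Data.Product using (_,_)
open import Function.Base using (_∘_)
open import Function.Bundles using (_⇔_; mk⇔; Equivalence)
open Equivalence using (to; from)
open import Relation.Binary.PropositionalEquality
open import Relation.Nullary using (¬_; Dec; yes; no; contradiction)

private variable n : ℕ

flip-≢ : (x : BinStr n) {i k : Fin n} → i ≢ k → flip x i k ≡ x k
flip-≢ x {i} {k} i≢k with i ≟ k
... | yes i≡k = contradiction i≡k i≢k
... | no _    = refl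

flip-≡ : (x : BinStr n) {i k : Fin n} → i ≡ k → flip x i k ≡ not (x k)
flip-≡ x {i} {k} i≡k with i ≟ k
... | yes _   = refl
... | no i≢k  = contradiction i≡k i≢k

flip-cong : (x y : BinStr n) (i k : Fin n) → x k ≡ y k → flip x i k ≡ flip y i k
flip-cong x y i k xk≡yk with i ≟ k
... | yes _ = cong not xk≡yk
... | no _  = xk≡yk

flip-involutive : (x : BinStr n) (i : Fin n) → flip (flip x i) i ≗ x
flip-involutive x i k with i ≟ k
... | yes i≡k = trans (cong not (flip-≡ x i≡k)) (not-involutive (x k))
... | no i≢k  = flip-≢ x i≢k

flip-swap : (x y : BinStr n) (i : Fin n) → y ≗ flip x i → x ≗ flip y i
flip-swap x y i y≗ k = begin
  x k                  ≡⟨ flip-involutive x i k ⟨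
  flip (flip x i) i k  ≡⟨ flip-cong (flip x i) y i k (sym (y≗ k)) ⟩
  flip y i k           ∎
  where open ≡-Reasoning

module _ {m : ℕ} where

  toℕ-cycShift : (a : Fin (suc m)) (d : ℕ) → toℕ (cycShift a d) ≡ (toℕ a + d) % suc m
  toℕ-cycShift a d = toℕ-fromℕ< _

  next-fromℕ< : ∀ {k} (k<n : k < suc m) (1+k<n : suc k < suc m) →
                next (fromℕ< k<n) ≡ fromℕ< 1+k<n
  next-fromℕ< {k} k<n 1+k<n = toℕ-injective (begin
    toℕ (next (fromℕ< k<n))         ≡⟨ toℕ-cycShift (fromℕ< k<n) 1 ⟩
    (toℕ (fromℕ< k<n) + 1) % suc m  ≡⟨ cong (λ t → (t + 1) % suc m) (toℕ-fromℕ< k<n) ⟩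
    (k + 1) % suc m                 ≡⟨ cong (_% suc m) (+-comm k 1) ⟩
    suc k % suc m                   ≡⟨ m<n⇒m%n≡m 1+k<n ⟩
    suc k                           ≡⟨ toℕ-fromℕ< 1+k<n ⟨
    toℕ (fromℕ< 1+k<n)              ∎)
    where open ≡-Reasoning

  next-fromℕ : next (fromℕ m) ≡ zero
  next-fromℕ = toℕ-injective (begin
    toℕ (next (fromℕ m))         ≡⟨ toℕ-cycShift (fromℕ m) 1 ⟩
    (toℕ (fromℕ m) + 1) % suc m  ≡⟨ cong (λ t → (t + 1) % suc m) (toℕ-fromℕ m) ⟩
    (m + 1) % suc m              ≡⟨ cong (_% suc m) (+-comm m 1) ⟩
    suc m % suc m                ≡⟨ n%n≡0 (suc m) ⟩
    0                            ∎)
    where open ≡-Reasoning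

  prev-next : (a : Fin (suc m)) → prev (next a) ≡ a
  prev-next a = toℕ-injective (begin
    toℕ (prev (next a))                        ≡⟨ toℕ-cycShift (next a) m ⟩
    (toℕ (next a) + m) % suc m                 ≡⟨ cong (λ t → (t + m) % suc m) (toℕ-cycShift a 1) ⟩
    ((toℕ a + 1) % suc m + m) % suc m          ≡⟨ %-distribˡ-+ ((toℕ a + 1) % suc m) m (suc m) ⟩
    ((toℕ a + 1) % suc m % suc m + m % suc m) % suc m
      ≡⟨ cong (λ t → (t + m % suc m) % suc m) (m%n%n≡m%n (toℕ a + 1) (suc m)) ⟩
    ((toℕ a + 1) % suc m + m % suc m) % suc m  ≡⟨ %-distribˡ-+ (toℕ a + 1) m (suc m) ⟨
    (toℕ a + 1 + m) % suc m                    ≡⟨ cong (_% suc m) (+-assoc (toℕ a) 1 m) ⟩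
    (toℕ a + suc m) % suc m                    ≡⟨ [m+n]%n≡m%n (toℕ a) (suc m) ⟩
    toℕ a % suc m                              ≡⟨ m<n⇒m%n≡m (toℕ<n a) ⟩
    toℕ a                                      ∎)
    where open ≡-Reasoning

BothOnes : BinStr n → Fin n → Fin n → Set
BothOnes b a c = b a ∧ b c ≡ true

bothOnes-resp : (u v : BinStr n) {a c : Fin n} → u a ≡ v a → u c ≡ v c →
                BothOnes u a c → BothOnes v a c
bothOnes-resp u v ua≡va uc≡vc = subst (_≡ true) (cong₂ _∧_ ua≡va uc≡vc)

NoCyclicConsecutiveOnes : (n : ℕ) → BinStr n → Set
NoCyclicConsecutiveOnes n b = (a : Fin n) → ¬ BothOnes b a (next a)

noCyclicConsecutiveOnes-resp-≗ : (u v : BinStr n) → u ≗ v →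
  NoCyclicConsecutiveOnes n u → NoCyclicConsecutiveOnes n v
noCyclicConsecutiveOnes-resp-≗ u v u≗v noU a =
  noU a ∘ bothOnes-resp v u (sym (u≗v a)) (sym (u≗v (next a)))

isLucas⇒noCyclicConsecutiveOnes : (b : BinStr n) → IsLucas n b → NoCyclicConsecutiveOnes n b
isLucas⇒noCyclicConsecutiveOnes {suc m} b (noConsecutive , firstLast) a
  with toℕ a ℕ.≟ m
... | yes a≡m = subst (λ c → ¬ BothOnes b c (next c)) (sym a≡last) wrapAround
  where
  a≡last : a ≡ fromℕ m
  a≡last = toℕ-injective (trans a≡m (sym (toℕ-fromℕ m)))
  wrapAround : ¬ BothOnes b (fromℕ m) (next (fromℕ m))
  wrapAround ones =
    firstLast (trans (∧-comm (b zero) (b (fromℕ m))) (subst (BothOnes b (fromℕ m)) next-fromℕ ones))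
... | no a≢m = subst₂ (λ c c′ → ¬ BothOnes b c c′) (fromℕ<-toℕ a _) fromℕ<1+a≡next
                 (noConsecutive (toℕ a) 1+a<n)
  where
  1+a<n : suc (toℕ a) < suc m
  1+a<n = s≤s (≤∧≢⇒< (toℕ≤pred[n] a) a≢m)
  fromℕ<1+a≡next : fromℕ< 1+a<n ≡ next a
  fromℕ<1+a≡next = trans (sym (next-fromℕ< (toℕ<n a) 1+a<n)) (cong next (fromℕ<-toℕ a _))

noCyclicConsecutiveOnes⇒isLucas : (b : BinStr n) → NoCyclicConsecutiveOnes n b → IsLucas n b
noCyclicConsecutiveOnes⇒isLucas {zero}  b _ = (λ _ ()) , λ ()
noCyclicConsecutiveOnes⇒isLucas {suc m} b noCyclic = noConsecutive , firstLast
  where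
  noConsecutive : NoConsecutiveOnes (suc m) b
  noConsecutive k 1+k<n = subst (λ c → ¬ BothOnes b (fromℕ< k<n) c) (next-fromℕ< k<n 1+k<n)
                            (noCyclic (fromℕ< k<n))
    where
    k<n : k < suc m
    k<n = <-trans (n<1+n k) 1+k<n
  firstLast : FirstLastNotBoth (suc m) b
  firstLast ones = noCyclic (fromℕ m)
    (subst (BothOnes b (fromℕ m)) (sym next-fromℕ) (trans (∧-comm (b (fromℕ m)) (b zero)) ones))

isLucas⇔noCyclicConsecutiveOnes : (b : BinStr n) → IsLucas n b ⇔ NoCyclicConsecutiveOnes n b
isLucas⇔noCyclicConsecutiveOnes b =
  mk⇔ (isLucas⇒noCyclicConsecutiveOnes b) (noCyclicConsecutiveOnes⇒isLucas b)

noCyclicConsecutiveOnes-flip : (x y : BinStr n) (i j : Fin n) → y ≗ flip x i →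
  j ≢ prev i → j ≢ next i →
  NoCyclicConsecutiveOnes n x → NoCyclicConsecutiveOnes n y →
  NoCyclicConsecutiveOnes n (flip x j) → NoCyclicConsecutiveOnes n (flip y j)
noCyclicConsecutiveOnes-flip {suc _} x y i j y≗ j≢prev j≢next noX noY noXj with j ≟ i
... | yes refl = noCyclicConsecutiveOnes-resp-≗ x (flip y i) (flip-swap x y i y≗) noX
... | no j≢i  = λ a → onPair a (a ≟ i) (next a ≟ i)
  where
  viaY : ∀ {a} → j ≢ a → j ≢ next a → ¬ BothOnes (flip y j) a (next a)
  viaY {a} j≢a j≢a′ = noY a ∘ bothOnes-resp (flip y j) y (flip-≢ y j≢a) (flip-≢ y j≢a′)

  agreeOffI : ∀ {c} → c ≢ i → flip y j c ≡ flip x j c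
  agreeOffI {c} c≢i = flip-cong y x j c (trans (y≗ c) (flip-≢ x (c≢i ∘ sym)))

  viaFlipX : ∀ {a} → a ≢ i → next a ≢ i → ¬ BothOnes (flip y j) a (next a)
  viaFlipX {a} a≢i a′≢i = noXj a ∘ bothOnes-resp (flip y j) (flip x j) (agreeOffI a≢i) (agreeOffI a′≢i)

  onPair : ∀ a → Dec (a ≡ i) → Dec (next a ≡ i) → ¬ BothOnes (flip y j) a (next a)
  onPair a (yes a≡i) _          = viaY (j≢i ∘ λ j≡a → trans j≡a a≡i)
                                       (j≢next ∘ λ j≡a′ → trans j≡a′ (cong next a≡i))
  onPair a (no _)    (yes a′≡i) = viaY (j≢prev ∘ λ j≡a → trans j≡a (trans (sym (prev-next a)) (cong prev a′≡i)))
                                       (j≢i ∘ λ j≡a′ → trans j≡a′ a′≡i)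
  onPair a (no a≢i)  (no a′≢i)  = viaFlipX a≢i a′≢i

isLucas-flip : (x y : BinStr n) (i j : Fin n) → y ≗ flip x i →
  j ≢ prev i → j ≢ next i →
  IsLucas n x → IsLucas n y → IsLucas n (flip x j) → IsLucas n (flip y j)
isLucas-flip {n} x y i j y≗ j≢prev j≢next lx ly lxj =
  from (isLucas⇔noCyclicConsecutiveOnes (flip y j))
    (noCyclicConsecutiveOnes-flip x y i j y≗ j≢prev j≢next (cyclic x lx) (cyclic y ly) (cyclic (flip x j) lxj))
  where
  cyclic : (b : BinStr n) → IsLucas n b → NoCyclicConsecutiveOnes n b
  cyclic b = to (isLucas⇔noCyclicConsecutiveOnes b)

mainTheorem10 : (n : ℕ) (x y : BinStr n) (i : Fin n) →
    IsLucas n x → IsLucas n y → (∀ k → y k ≡ flip x i k) →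
    (j : Fin n) → ¬ (j ≡ prev i) → ¬ (j ≡ next i) →
    IsLucas n (flip x j) ⇔ IsLucas n (flip y j)
mainTheorem10 n x y i lx ly y≗ j j≢prev j≢next =
  mk⇔ (isLucas-flip x y i j y≗ j≢prev j≢next lx ly)
      (isLucas-flip y x i j (flip-swap x y i y≗) j≢prev j≢next ly lx)
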